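{- Let $q\ge2$ and $n\ge1$ be integers and let $\mathcal{E}_q=\{x\mapsto[\![x=t]\!]\}_{t\in[q\rangle}$. (a) Under scenario $(*\bullet)$, $\mathcal{E}_q$ is $n$-cell implementable if and only if $q\le \binom{n}{\lfloor n/3\rfloor}\cdot 2^{\lceil 2n/3\rceil}$. (b) Under scenario $(\bullet\bullet)$, $\mathcal{E}_q$ is $n$-cell implementable if and only if $q\le\binom{2n}{n}$.
   Context: $[b\rangle=\{0,1,\ldots,b-1\}$. Let $\mathbb{B}=\{0,1\}$, $\mathbb{B}_\circ=\mathbb{B}$, $\mathbb{B}_*=\mathbb{B}\cup\{*\}$, $\mathbb{B}_\bullet=\mathbb{B}\cup\{*,\bullet\}$. Define $\mathrm{T}:\mathbb{B}_\bullet^2\to\mathbb{B}$ by $\mathrm{T}(u,\vartheta)=1$ if and only if $u=*$, or $\vartheta=*$, or $u=\vartheta\in\mathbb{B}$. $[\![\cdot]\!]$ is the Iverson bracket. $\mathcal{F}_q$ is the set of all functions $[q\rangle\to\mathbb{B}$. For $\alpha,\beta\in\{\circ,*,\bullet\}$, a subset $\Phi\subseteq\mathcal{F}_q$ is $n$-cell implementable under scenario $(\alpha\beta)$ if there exist mappings $\mathbf{u}=(u_j)_{j\in[n\rangle}:[q\rangle\to\mathbb{B}_\alpha^n$ and $\boldsymbol{\vartheta}=(\vartheta_j)_{j\in[n\rangle}:\Phi\to\mathbb{B}_\beta^n$ such that $f(x)=\bigwedge_{j\in[n\rangle}\mathrm{T}(u_j(x),\vartheta_j(f))$ for all $f\in\Phi$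 and $x\in[q\rangle$. -}

module Defs where

open import Data.Nat using (ℕ; _+_; _*_; _^_; _/_)
open import Data.Nat.Combinatorics using (_C_)
open import Data.Fin using (Fin; _≟_)
open import Data.Bool using (Bool; true; false; _∧_)
open import Data.Product using (Σ; ∃; _×_)
open import Data.Unit using (⊤)
open import Data.Empty using (⊥)
open import Relation.Binary.PropositionalEquality using (_≡_)
open import Relation.Nullary.Decidable using (⌊_⌋)

data Sym : Set where
  s0 s1 star bullet : Sym

data Scen : Set where
  ∘ₛ *ₛ •ₛ : Scen

InAlph : Scen → Sym → Set
InAlph ∘ₛ s0 = ⊤
InAlph ∘ₛ s1 = ⊤
InAlph ∘ₛ star = ⊥
InAlph ∘ₛ bullet = ⊥
InAlph *ₛ s0 = ⊤
InAlph *ₛ s1 = ⊤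
InAlph *ₛ star = ⊤
InAlph *ₛ bullet = ⊥
InAlph •ₛ _ = ⊤

T : Sym → Sym → Bool
T star _ = true
T _ star = true
T s0 s0 = true
T s1 s1 = true
T _ _ = false

⋀ : (n : ℕ) → (Fin n → Bool) → Bool
⋀ ℕ.zero g = true
⋀ (ℕ.suc n) g = g Fin.zero ∧ ⋀ n (λ j → g (Fin.suc j))

Family : ℕ → Set₁
Family q = (Fin q → Bool) → Set

Implementable : (α β : Scen) (q n : ℕ) → Family q → Set
Implementable α β q n Φ =
  Σ (Fin q → Fin n → Sym) λ u →
  Σ ((f : Fin q → Bool) → Φ f → Fin n → Sym) λ ϑ →
    ((x : Fin q) (j : Fin n) → InAlph α (u x j)) ×
    ((f : Fin q → Bool) (φ : Φ f) (j : Fin n) → InAlph β (ϑ f φ j)) ×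
    ((f : Fin q → Bool) (φ : Φ f) (x : Fin q) →
       f x ≡ ⋀ n (λ j → T (u x j) (ϑ f φ j)))

E : (q : ℕ) → Family q
E q f = ∃ λ (t : Fin q) → (x : Fin q) → f x ≡ ⌊ x ≟ t ⌋

-- ⌈2n/3⌉ = ⌊(2n+2)/3⌋
ceil2n/3 : ℕ → ℕ
ceil2n/3 n = (2 * n + 2) / 3

boundA : ℕ → ℕ
boundA n = (n C (n / 3)) * 2 ^ ceil2n/3 n

boundB : ℕ → ℕ
boundB n = (2 * n) C n

-- Both upper bounds are Lubell-type double counts. In scenario (*•) the cell vectors u_x ∈ 𝔹_*^n are
-- faces of the cube 𝔹^n, none containing another: if u_x ⊇ u_t then T(u_x j, ϑ_t j) ≥ T(u_t j, ϑ_t j) = 1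
-- for every cell j, forcing f_t(x) = 1. A face with s stars and r fixed bits lies on 2^s s! r! of the
-- 2^n n! maximal chains of the face lattice, so q ≤ max_{s+r=n} C(n, s) 2^r, attained at s = ⌊n/3⌋.
-- In scenario (••) the bits rejected by u_x and the bits demanded by ϑ_x are disjoint sets A_x, B_x of
-- (cell, bit) positions, 2n in all, and A_x meets B_t whenever x ≠ t; Bollobás' counting of permutations
-- gives ∑_x 1/C(|A_x| + |B_x|, |A_x|) ≤ 1, hence q ≤ C(2n, n).
-- Conversely, codewords of constant weight implement 𝓔_q: faces with exactly ⌊n/3⌋ stars, resp. words
-- admitting n bits in total. Letterwise, T(U a, Θ b) = 1 only if weight b ≤ weight a, with equality only
-- for a = b, so between words of equal total weight the test passes only on the diagonal.

module Submission where

open import Defs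
open import Data.Nat using (ℕ; _≤_)
open import Data.Product using (_×_)
open import Function.Bundles using (_⇔_)

open import Data.Nat hiding (_≟_)
open import Data.Nat.Properties hiding (_≟_)
open import Data.Nat.DivMod
open import Data.Nat.Divisibility using (n∣m*n)
open import Data.Nat.Combinatorics using (_C_; nCk+nC[k+1]≡[n+1]C[k+1]; nCn≡1)
open import Data.Nat.Tactic.RingSolver using (solve-∀)
open import Data.Bool using (Bool; true; false; if_then_else_; _∧_; not)
open import Data.Bool.Properties using () renaming (_≟_ to _≟ᵇ_)
open import Data.Fin using (Fin; zero; suc; punchIn; punchOut; _≟_; splitAt; join; inject≤; _↑ˡ_; _↑ʳ_)
open import Data.Fin.Properties
  using (punchInᵢ≢i; punchIn-punchOut; any?; all?; ¬∀⟶∃¬; join-splitAt; splitAt-↑ˡ; splitAt-↑ʳ; inject≤-injective)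
open import Data.List using (List; []; _∷_)
open import Data.List.Relation.Unary.Any using (here; there)
open import Data.List.Relation.Unary.All as All using ([]; _∷_)
open import Data.List.Relation.Unary.AllPairs using ([]; _∷_)
open import Data.List.Relation.Unary.Unique.Propositional using (Unique)
open import Data.List.Membership.Propositional using (_∈_)
open import Data.Vec.Functional using (Vector; removeAt) renaming (_∷_ to _∷ᵥ_)
open import Data.Product using (∃; _,_; proj₁; proj₂)
open import Data.Sum using (_⊎_; inj₁; inj₂; [_,_]′)
open import Data.Unit using (tt)
open import Data.Empty using (⊥; ⊥-elim)
open import Function.Base using (_∘_)
open import Function.Bundles using (mk⇔)
open import Function.Definitions using (Injective)
open import Relation.Nullary using (¬_; Dec; yes; no; does; ¬?)
open import Relation.Nullary.Decidable using (⌊_⌋; _×-dec_; dec-true; dec-false; decidable-stable)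
open import Relation.Binary.PropositionalEquality
open import Algebra.Properties.Semiring.Sum +-*-semiring
  using (sum; sum-syntax; sum-cong-≗; sum-remove; ∑-distrib-+; ∑-comm; *-distribʳ-sum; sum-replicate-zero)

sum-zero : ∀ {n} {f : Vector ℕ n} → (∀ i → f i ≡ 0) → sum f ≡ 0
sum-zero {n} f≗0 = trans (sum-cong-≗ f≗0) (sum-replicate-zero n)

sum-const : ∀ n c → ∑[ i < n ] c ≡ n * c
sum-const zero    c = refl
sum-const (suc n) c = cong (c +_) (sum-const n c)

sum-mono-≤ : ∀ {n} {f g : Vector ℕ n} → (∀ i → f i ≤ g i) → sum f ≤ sum g
sum-mono-≤ {zero}  f≤g = z≤n
sum-mono-≤ {suc n} f≤g = +-mono-≤ (f≤g zero) (sum-mono-≤ (f≤g ∘ suc))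

≤-sum : ∀ {n} (f : Vector ℕ (suc n)) i → f i ≤ sum f
≤-sum f i = ≤-trans (m≤m+n (f i) _) (≤-reflexive (sym (sum-remove {i = i} f)))

sum-single : ∀ {n} (f : Vector ℕ n) i → (∀ j → ¬ j ≡ i → f j ≡ 0) → sum f ≡ f i
sum-single {suc n} f i others-0 = begin
  sum f                                ≡⟨ sum-remove {i = i} f ⟩
  f i + ∑[ j < n ] f (punchIn i j)     ≡⟨ cong (f i +_) (sum-zero λ j → others-0 _ (punchInᵢ≢i i j)) ⟩
  f i + 0                              ≡⟨ +-identityʳ (f i) ⟩
  f i                                  ∎
  where open ≡-Reasoning

sum-≤-≡⇒≗ : ∀ {n} {f g : Vector ℕ n} → (∀ i → f i ≤ g i) → sum f ≡ sum g → ∀ i → f i ≡ g i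
sum-≤-≡⇒≗ {suc n} {f} {g} f≤g Σf≡Σg = λ { zero → head≡ ; (suc i) → sum-≤-≡⇒≗ (λ i → f≤g (suc i)) tail≡ i }
  where
  head≡ : f zero ≡ g zero
  head≡ = ≤-antisym (f≤g zero) (+-cancelʳ-≤ _ _ _ (≤-trans
            (+-monoʳ-≤ (g zero) (sum-mono-≤ λ i → f≤g (suc i))) (≤-reflexive (sym Σf≡Σg))))
  tail≡ : ∑[ i < n ] f (suc i) ≡ ∑[ i < n ] g (suc i)
  tail≡ = +-cancelˡ-≡ (f zero) _ _ (trans Σf≡Σg (cong (_+ _) (sym head≡)))

binom : ℕ → ℕ → ℕ
binom zero    r       = 1
binom (suc s) zero    = 1
binom (suc s) (suc r) = binom s (suc r) + binom (suc s) r

binom-comm : ∀ s r → binom s r ≡ binom r s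
binom-comm zero    zero    = refl
binom-comm zero    (suc r) = refl
binom-comm (suc s) zero    = refl
binom-comm (suc s) (suc r) =
  trans (cong₂ _+_ (binom-comm s (suc r)) (binom-comm (suc s) r)) (+-comm (binom (suc r) s) _)

binom-zeroʳ : ∀ s → binom s 0 ≡ 1
binom-zeroʳ zero    = refl
binom-zeroʳ (suc s) = refl

binom≡C : ∀ s r → binom s r ≡ (s + r) C s
binom≡C zero    r       = refl
binom≡C (suc s) zero    = sym (trans (cong (_C suc s) (+-identityʳ (suc s))) (nCn≡1 (suc s)))
binom≡C (suc s) (suc r) = begin
  binom s (suc r) + binom (suc s) r          ≡⟨ cong₂ _+_ (binom≡C s (suc r)) (binom≡C (suc s) r) ⟩
  (s + suc r) C s + (suc s + r) C suc s      ≡⟨ cong (λ m → (s + suc r) C s + m C suc s) (sym (+-suc s r)) ⟩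
  (s + suc r) C s + (s + suc r) C suc s      ≡⟨ nCk+nC[k+1]≡[n+1]C[k+1] (s + suc r) s ⟩
  (suc s + suc r) C suc s                    ∎
  where open ≡-Reasoning

binom-*-factorials : ∀ s r → binom s r * (s ! * r !) ≡ (s + r) !
binom-*-factorials zero    r       = trans (+-identityʳ _) (+-identityʳ _)
binom-*-factorials (suc s) zero    =
  trans (+-identityʳ _) (trans (*-identityʳ _) (cong _! (sym (+-identityʳ (suc s)))))
binom-*-factorials (suc s) (suc r) = begin
  (binom s (suc r) + binom (suc s) r) * (suc s ! * suc r !)
    ≡⟨ split (binom s (suc r)) (binom (suc s) r) s r (s !) (r !) ⟩
  suc s * (binom s (suc r) * (s ! * suc r !)) + suc r * (binom (suc s) r * (suc s ! * r !))
    ≡⟨ cong₂ (λ a b → suc s * a + suc r * b) (binom-*-factorials s (suc r)) (binom-*-factorials (suc s) r) ⟩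
  suc s * (s + suc r) ! + suc r * (suc s + r) !
    ≡⟨ cong (λ m → suc s * (s + suc r) ! + suc r * m !) (sym (+-suc s r)) ⟩
  suc s * (s + suc r) ! + suc r * (s + suc r) !
    ≡⟨ sym (*-distribʳ-+ ((s + suc r) !) (suc s) (suc r)) ⟩
  (suc s + suc r) !
    ∎
  where
  open ≡-Reasoning
  split : ∀ a b s r p q → (a + b) * ((suc s * p) * (suc r * q)) ≡
          suc s * (a * (p * (suc r * q))) + suc r * (b * ((suc s * p) * q))
  split = solve-∀

binom-sucʳ : ∀ s r → binom s (suc r) * suc r ≡ suc (s + r) * binom s r
binom-sucʳ s r = *-cancelʳ-≡ _ _ (s ! * r !) {{s !* r !≢0}} (begin
  binom s (suc r) * suc r * (s ! * r !)      ≡⟨ regroup (binom s (suc r)) r (s !) (r !) ⟩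
  binom s (suc r) * (s ! * suc r !)          ≡⟨ binom-*-factorials s (suc r) ⟩
  (s + suc r) !                              ≡⟨ cong _! (+-suc s r) ⟩
  suc (s + r) * (s + r) !                    ≡⟨ cong (suc (s + r) *_) (sym (binom-*-factorials s r)) ⟩
  suc (s + r) * (binom s r * (s ! * r !))    ≡⟨ sym (*-assoc (suc (s + r)) (binom s r) _) ⟩
  suc (s + r) * binom s r * (s ! * r !)      ∎)
  where
  open ≡-Reasoning
  regroup : ∀ b r p q → b * suc r * (p * q) ≡ b * (p * (suc r * q))
  regroup = solve-∀

binom-shift : ∀ s r → binom (suc s) r * suc s ≡ binom s (suc r) * suc r
binom-shift s r = begin
  binom (suc s) r * suc s     ≡⟨ cong (_* suc s) (binom-comm (suc s) r) ⟩
  binom r (suc s) * suc s     ≡⟨ binom-sucʳ r s ⟩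
  suc (r + s) * binom r s     ≡⟨ cong₂ (λ m b → suc m * b) (+-comm r s) (binom-comm r s) ⟩
  suc (s + r) * binom s r     ≡⟨ sym (binom-sucʳ s r) ⟩
  binom s (suc r) * suc r     ∎
  where open ≡-Reasoning

binom-shift-≤ : ∀ {s r} → r ≤ s → binom (suc s) r ≤ binom s (suc r)
binom-shift-≤ {s} {r} r≤s = *-cancelʳ-≤ _ _ (suc s)
  (≤-trans (≤-reflexive (binom-shift s r)) (*-monoʳ-≤ (binom s (suc r)) (s≤s r≤s)))

binom-≤-sucʳ : ∀ s r → binom s r ≤ binom s (suc r)
binom-≤-sucʳ zero    r = ≤-refl
binom-≤-sucʳ (suc s) r = m≤n+m _ _

binom-monoʳ-≤ : ∀ s {r r′} → r ≤ r′ → binom s r ≤ binom s r′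
binom-monoʳ-≤ s {r} r≤r′ = subst (λ m → binom s r ≤ binom s m) (m∸n+n≡m r≤r′) (go (_ ∸ r))
  where
  go : ∀ d → binom s r ≤ binom s (d + r)
  go zero    = ≤-refl
  go (suc d) = ≤-trans (go d) (binom-≤-sucʳ s (d + r))

line-max : (g : ℕ → ℕ → ℕ) (k l : ℕ) →
  (∀ s r → s < k → s + suc r ≡ k + l → g s (suc r) ≤ g (suc s) r) →
  (∀ s r → k ≤ s → s + suc r ≡ k + l → g (suc s) r ≤ g s (suc r)) →
  ∀ s r → s + r ≡ k + l → g s r ≤ g k l
line-max g k l up down s r s+r≡k+l with ≤-total s k
... | inj₁ s≤k = subst (λ m → g s m ≤ g k l) d+l≡r (climb d s s+d≡k)
  where
  d = k ∸ s
  s+d≡k : s + d ≡ k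
  s+d≡k = m+[n∸m]≡n s≤k
  d+l≡r : d + l ≡ r
  d+l≡r = +-cancelˡ-≡ s _ _ (trans (sym (+-assoc s d l)) (trans (cong (_+ l) s+d≡k) (sym s+r≡k+l)))
  climb : ∀ d s → s + d ≡ k → g s (d + l) ≤ g k l
  climb zero    s s+0≡k = ≤-reflexive (cong (λ m → g m l) (trans (sym (+-identityʳ s)) s+0≡k))
  climb (suc d) s s+d≡k = ≤-trans (up s (d + l) s<k on-line) (climb d (suc s) 1+s+d≡k)
    where
    1+s+d≡k : suc s + d ≡ k
    1+s+d≡k = trans (sym (+-suc s d)) s+d≡k
    s<k : s < k
    s<k = ≤-trans (s≤s (m≤m+n s d)) (≤-reflexive 1+s+d≡k)
    on-line : s + suc (d + l) ≡ k + l
    on-line = trans (sym (+-assoc s (suc d) l)) (cong (_+ l) s+d≡k)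
... | inj₂ k≤s = subst (λ m → g m r ≤ g k l) d+k≡s (descend d r r+d≡l)
  where
  d = s ∸ k
  d+k≡s : d + k ≡ s
  d+k≡s = m∸n+n≡m k≤s
  r+d≡l : r + d ≡ l
  r+d≡l = +-cancelˡ-≡ k _ _ (trans (rearrange k r d) (trans (cong (_+ r) d+k≡s) s+r≡k+l))
    where
    rearrange : ∀ k r d → k + (r + d) ≡ d + k + r
    rearrange = solve-∀
  descend : ∀ d r → r + d ≡ l → g (d + k) r ≤ g k l
  descend zero    r r+0≡l = ≤-reflexive (cong (g k) (trans (sym (+-identityʳ r)) r+0≡l))
  descend (suc d) r r+d≡l = ≤-trans (down (d + k) r (m≤n+m k d) on-line) (descend d (suc r) 1+r+d≡l)
    where
    1+r+d≡l : suc r + d ≡ l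
    1+r+d≡l = trans (sym (+-suc r d)) r+d≡l
    on-line : d + k + suc r ≡ k + l
    on-line = trans (rearrange d k r) (cong (k +_) r+d≡l)
      where
      rearrange : ∀ d k r → d + k + suc r ≡ k + (r + suc d)
      rearrange = solve-∀

binom-≤-central : ∀ n a b → a + b ≤ n + n → binom a b ≤ binom n n
binom-≤-central n a b a+b≤2n = ≤-trans
  (binom-monoʳ-≤ a (+-cancelˡ-≤ a _ _ (subst (a + b ≤_) (sym a+rest≡2n) a+b≤2n)))
  (line-max binom n n up down a (n + n ∸ a) a+rest≡2n)
  where
  a+rest≡2n : a + (n + n ∸ a) ≡ n + n
  a+rest≡2n = m+[n∸m]≡n (≤-trans (m≤m+n a b) a+b≤2n)
  up : ∀ s r → s < n → s + suc r ≡ n + n → binom s (suc r) ≤ binom (suc s) r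
  up s r s<n eq = subst₂ _≤_ (binom-comm (suc r) s) (binom-comm r (suc s)) (binom-shift-≤ (<⇒≤ (≤-pred
    (+-cancelˡ-≤ s (suc (suc s)) (suc r) (begin
      s + suc (suc s)  ≡⟨ +-suc s (suc s) ⟩
      suc s + suc s    ≤⟨ +-mono-≤ s<n s<n ⟩
      n + n            ≡⟨ sym eq ⟩
      s + suc r        ∎)))))
    where open ≤-Reasoning
  down : ∀ s r → n ≤ s → s + suc r ≡ n + n → binom (suc s) r ≤ binom s (suc r)
  down s r n≤s eq = binom-shift-≤ (<⇒≤ (+-cancelˡ-≤ s _ _ (≤-trans (≤-reflexive eq) (+-mono-≤ n≤s n≤s))))

binom*2^-shift : ∀ s r → binom (suc s) r * 2 ^ r * (2 * suc s) ≡ binom s (suc r) * 2 ^ suc r * suc r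
binom*2^-shift s r = begin
  binom (suc s) r * 2 ^ r * (2 * suc s)   ≡⟨ regroup (binom (suc s) r) (2 ^ r) (suc s) ⟩
  binom (suc s) r * suc s * (2 * 2 ^ r)   ≡⟨ cong (_* 2 ^ suc r) (binom-shift s r) ⟩
  binom s (suc r) * suc r * (2 * 2 ^ r)   ≡⟨ regroup′ (binom s (suc r)) (2 ^ r) (suc r) ⟩
  binom s (suc r) * 2 ^ suc r * suc r     ∎
  where
  open ≡-Reasoning
  regroup : ∀ b p m → b * p * (2 * m) ≡ b * m * (2 * p)
  regroup = solve-∀
  regroup′ : ∀ b p m → b * m * (2 * p) ≡ b * (2 * p) * m
  regroup′ = solve-∀

-- ⌈2N/3⌉ = 2⌊N/3⌋ + (N mod 3)
thirds : ∀ N → (N / 3 + ceil2n/3 N ≡ N) × (2 * (N / 3) ≤ ceil2n/3 N) × (ceil2n/3 N ≤ 2 * (N / 3) + 2)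
thirds N = k+l≡N , subst (2 * k ≤_) (sym l≡) (m≤n+m (2 * k) ρ) ,
  subst (_≤ 2 * k + 2) (sym l≡) (≤-trans (≤-reflexive (+-comm ρ (2 * k))) (+-monoʳ-≤ (2 * k) (≤-pred ρ<3)))
  where
  k = N / 3
  ρ = N % 3
  ρ<3 : ρ < 3
  ρ<3 = m%n<n N 3
  N≡ : N ≡ ρ + k * 3
  N≡ = m≡m%n+[m/n]*n N 3
  small : ∀ ρ → ρ < 3 → (2 * ρ + 2) / 3 ≡ ρ
  small 0 _ = refl
  small 1 _ = refl
  small 2 _ = refl
  small (suc (suc (suc _))) (s≤s (s≤s (s≤s ())))
  l≡ : ceil2n/3 N ≡ ρ + 2 * k
  l≡ = begin
    (2 * N + 2) / 3                    ≡⟨ /-congˡ (trans (cong (λ m → 2 * m + 2) N≡) (expand ρ k)) ⟩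
    ((2 * ρ + 2) + (2 * k) * 3) / 3    ≡⟨ +-distrib-/-∣ʳ (2 * ρ + 2) (n∣m*n (2 * k)) ⟩
    (2 * ρ + 2) / 3 + (2 * k) * 3 / 3  ≡⟨ cong₂ _+_ (small ρ ρ<3) (m*n/n≡m (2 * k) 3) ⟩
    ρ + 2 * k                          ∎
    where
    open ≡-Reasoning
    expand : ∀ ρ k → 2 * (ρ + k * 3) + 2 ≡ (2 * ρ + 2) + (2 * k) * 3
    expand = solve-∀
  k+l≡N : k + ceil2n/3 N ≡ N
  k+l≡N = trans (cong (k +_) l≡) (trans (collect ρ k) (sym N≡))
    where
    collect : ∀ ρ k → k + (ρ + 2 * k) ≡ ρ + k * 3
    collect = solve-∀

binom*2^-≤-boundA : ∀ N s r → s + r ≡ N → binom s r * 2 ^ r ≤ boundA N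
binom*2^-≤-boundA N s r s+r≡N = subst (binom s r * 2 ^ r ≤_) at-k,l≡boundA
  (line-max (λ s r → binom s r * 2 ^ r) k l up down s r (trans s+r≡N (sym k+l≡N)))
  where
  k = N / 3
  l = ceil2n/3 N
  k+l≡N : k + l ≡ N
  k+l≡N = proj₁ (thirds N)
  2k≤l : 2 * k ≤ l
  2k≤l = proj₁ (proj₂ (thirds N))
  l≤2k+2 : l ≤ 2 * k + 2
  l≤2k+2 = proj₂ (proj₂ (thirds N))
  at-k,l≡boundA : binom k l * 2 ^ l ≡ boundA N
  at-k,l≡boundA = cong (_* 2 ^ l) (trans (binom≡C k l) (cong (_C k) k+l≡N))
  up : ∀ s r → s < k → s + suc r ≡ k + l → binom s (suc r) * 2 ^ suc r ≤ binom (suc s) r * 2 ^ r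
  up s r s<k eq = *-cancelʳ-≤ _ _ (suc r) (begin
    binom s (suc r) * 2 ^ suc r * suc r      ≡⟨ sym (binom*2^-shift s r) ⟩
    binom (suc s) r * 2 ^ r * (2 * suc s)    ≤⟨ *-monoʳ-≤ (binom (suc s) r * 2 ^ r) 2[s+1]≤r+1 ⟩
    binom (suc s) r * 2 ^ r * suc r          ∎)
    where
    open ≤-Reasoning
    2[s+1]≤r+1 : 2 * suc s ≤ suc r
    2[s+1]≤r+1 = +-cancelˡ-≤ (suc s) _ _ (begin
      suc s + 2 * suc s  ≤⟨ +-mono-≤ s<k (*-monoʳ-≤ 2 s<k) ⟩
      k + 2 * k          ≤⟨ +-monoʳ-≤ k 2k≤l ⟩
      k + l              ≡⟨ sym eq ⟩
      s + suc r          ≤⟨ n≤1+n _ ⟩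
      suc s + suc r      ∎)
  down : ∀ s r → k ≤ s → s + suc r ≡ k + l → binom (suc s) r * 2 ^ r ≤ binom s (suc r) * 2 ^ suc r
  down s r k≤s eq = *-cancelʳ-≤ _ _ (2 * suc s) (begin
    binom (suc s) r * 2 ^ r * (2 * suc s)    ≡⟨ binom*2^-shift s r ⟩
    binom s (suc r) * 2 ^ suc r * suc r      ≤⟨ *-monoʳ-≤ (binom s (suc r) * 2 ^ suc r) r+1≤2[s+1] ⟩
    binom s (suc r) * 2 ^ suc r * (2 * suc s) ∎)
    where
    open ≤-Reasoning
    r+1≤2[s+1] : suc r ≤ 2 * suc s
    r+1≤2[s+1] = +-cancelˡ-≤ s _ _ (begin
      s + suc r          ≡⟨ eq ⟩
      k + l              ≤⟨ +-monoʳ-≤ k l≤2k+2 ⟩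
      k + (2 * k + 2)    ≤⟨ +-mono-≤ k≤s (+-monoˡ-≤ 2 (*-monoʳ-≤ 2 k≤s)) ⟩
      s + (2 * s + 2)    ≡⟨ cong (s +_) (twice-suc s) ⟩
      s + 2 * suc s      ∎)
      where
      twice-suc : ∀ s → 2 * s + 2 ≡ 2 * suc s
      twice-suc = solve-∀

binom-≤-boundB : ∀ n a b → a + b ≤ n + n → binom a b ≤ boundB n
binom-≤-boundB n a b a+b≤2n = subst (binom a b ≤_) central≡boundB (binom-≤-central n a b a+b≤2n)
  where
  central≡boundB : binom n n ≡ boundB n
  central≡boundB = trans (binom≡C n n) (cong (λ m → (n + m) C n) (sym (+-identityʳ n)))

-- In Lubell's proof of the LYM inequality, total N counts the maximal chains and chains N w those
-- through w; below a non-terminal w a chain continues by deleting a coordinate e along one of the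
-- branches k admitted by the letter w e. Separated words share no chain.
module ChainCounting
  {S : Set} (branches : ℕ) (branch : Fin branches → S → Bool)
  (Terminal : ∀ {N} → Vector S N → Set) (terminal? : ∀ {N} (w : Vector S N) → Dec (Terminal w))
  (R : ∀ {N} → Vector S N → Vector S N → Set)
  (terminal-isolated : ∀ {N} {w w′ : Vector S N} → Terminal w → R w w′ → R w′ w → ⊥)
  (R-removeAt : ∀ {M} {w w′ : Vector S (suc M)} e k → branch k (w e) ≡ true → branch k (w′ e) ≡ true →
                R w w′ → R (removeAt w e) (removeAt w′ e))
  where

  total : ℕ → ℕ
  total N = branches ^ N * N !

  total≢0 : ∀ N .{{_ : NonZero branches}} → NonZero (total N)
  total≢0 N = m*n≢0 (branches ^ N) (N !) {{m^n≢0 branches N}} {{N !≢0}}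

  chains branching : ∀ N → Vector S N → ℕ
  chains N w = if does (terminal? w) then total N else branching N w
  branching zero    w = 0
  branching (suc M) w =
    ∑[ e < suc M ] ∑[ k < branches ] (if branch k (w e) then chains M (removeAt w e) else 0)

  chains-terminal : ∀ {N} {w : Vector S N} → Terminal w → chains N w ≡ total N
  chains-terminal {N} {w} t = cong (if_then total N else branching N w) (dec-true (terminal? w) t)

  chains-branching : ∀ {N} {w : Vector S N} → ¬ Terminal w → chains N w ≡ branching N w
  chains-branching {N} {w} ¬t = cong (if_then total N else branching N w) (dec-false (terminal? w) ¬t)

  Separated : ∀ {N q} → (Fin q → Vector S N) → (Fin q → Bool) → Set
  Separated w P = ∀ x t → P x ≡ true → P t ≡ true → ¬ x ≡ t → R (w x) (w t)

  ∑-chains-≤-total : ∀ N {q} (w : Fin q → Vector S N) P → Separated w P →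
                     ∑[ x < q ] (if P x then chains N (w x) else 0) ≤ total N
  ∑-branching-≤-total : ∀ N {q} (w : Fin q → Vector S N) P → Separated w P →
                        ∑[ x < q ] (if P x then branching N (w x) else 0) ≤ total N

  ∑-chains-≤-total N w P sep with any? (λ x → (P x ≟ᵇ true) ×-dec terminal? (w x))
  ... | yes (x₀ , Px₀ , t₀) = ≤-reflexive (begin
    ∑[ x < _ ] (if P x then chains N (w x) else 0) ≡⟨ sum-single _ x₀ others-vanish ⟩
    (if P x₀ then chains N (w x₀) else 0)         ≡⟨ cong (if_then chains N (w x₀) else 0) Px₀ ⟩
    chains N (w x₀)                                ≡⟨ chains-terminal t₀ ⟩
    total N                                        ∎)
    where
    open ≡-Reasoning
    others-vanish : ∀ x → ¬ x ≡ x₀ → (if P x then chains N (w x) else 0) ≡ 0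
    others-vanish x x≢x₀ with P x in Px
    ... | false = refl
    ... | true  = ⊥-elim (terminal-isolated t₀ (sep x₀ x Px₀ Px (x≢x₀ ∘ sym)) (sep x x₀ Px Px₀ x≢x₀))
  ... | no no-terminal = ≤-trans (≤-reflexive (sum-cong-≗ chains≗branching)) (∑-branching-≤-total N w P sep)
    where
    chains≗branching : ∀ x → (if P x then chains N (w x) else 0) ≡ (if P x then branching N (w x) else 0)
    chains≗branching x with P x in Px
    ... | false = refl
    ... | true  = chains-branching λ t → no-terminal (x , Px , t)

  ∑-branching-≤-total zero w P sep = ≤-trans (≤-reflexive (sum-zero λ x → if-0 (P x))) z≤n
    where
    if-0 : ∀ b → (if b then 0 else 0) ≡ 0
    if-0 true  = refl
    if-0 false = refl
  ∑-branching-≤-total (suc M) {q} w P sep = begin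
    ∑[ x < q ] (if P x then branching (suc M) (w x) else 0)  ≡⟨ sum-cong-≗ {q} (λ x → distribute (P x) x) ⟩
    ∑[ x < q ] ∑[ e < suc M ] ∑[ k < branches ] term x e k   ≡⟨ ∑-comm (λ x e → ∑[ k < branches ] term x e k) ⟩
    ∑[ e < suc M ] ∑[ x < q ] ∑[ k < branches ] term x e k   ≡⟨ sum-cong-≗ (λ e → ∑-comm (λ x k → term x e k)) ⟩
    ∑[ e < suc M ] ∑[ k < branches ] ∑[ x < q ] term x e k
      ≤⟨ sum-mono-≤ (λ e → sum-mono-≤ λ k →
           ∑-chains-≤-total M (λ x → removeAt (w x) e) (λ x → P x ∧ branch k (w x e)) (separated-removeAt e k)) ⟩
    ∑[ e < suc M ] ∑[ k < branches ] total M                 ≡⟨ sum-cong-≗ {suc M} (λ e → sum-const branches (total M)) ⟩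
    ∑[ e < suc M ] (branches * total M)                      ≡⟨ sum-const (suc M) _ ⟩
    suc M * (branches * total M)                             ≡⟨ regroup branches (branches ^ M) (M !) M ⟩
    total (suc M)                                            ∎
    where
    open ≤-Reasoning
    term : Fin q → Fin (suc M) → Fin branches → ℕ
    term x e k = if P x ∧ branch k (w x e) then chains M (removeAt (w x) e) else 0
    distribute : ∀ b x →
      (if b then branching (suc M) (w x) else 0) ≡
      ∑[ e < suc M ] ∑[ k < branches ] (if b ∧ branch k (w x e) then chains M (removeAt (w x) e) else 0)
    distribute true  x = refl
    distribute false x = sym (sum-zero {suc M} λ e → sum-zero {branches} λ k → refl)
    separated-removeAt : ∀ e k → Separated (λ x → removeAt (w x) e) (λ x → P x ∧ branch k (w x e))
    separated-removeAt e k x t Px∧ Pt∧ x≢t =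
      R-removeAt e k (∧-snd Px∧) (∧-snd Pt∧) (sep x t (∧-fst Px∧) (∧-fst Pt∧) x≢t)
      where
      ∧-fst : ∀ {a b} → a ∧ b ≡ true → a ≡ true
      ∧-fst {true} _ = refl
      ∧-snd : ∀ {a b} → a ∧ b ≡ true → b ≡ true
      ∧-snd {true} eq = eq
    regroup : ∀ b p f M → suc M * (b * (p * f)) ≡ b * p * (f + M * f)
    regroup = solve-∀

-- Faces of the cube

-- A word over Coord is a face of the cube 𝔹^N, free standing for *.
data Coord : Set where
  fixed : Bool → Coord
  free  : Coord

free? : (a : Coord) → Dec (a ≡ free)
free? (fixed _) = no λ ()
free? free      = yes refl

χfree χfixed : Coord → ℕ
χfree (fixed _) = 0
χfree free      = 1
χfixed (fixed _) = 1
χfixed free      = 0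

#free #fixed : ∀ {N} → Vector Coord N → ℕ
#free  w = sum (χfree ∘ w)
#fixed w = sum (χfixed ∘ w)

fixedAt : Fin 2 → Coord → Bool
fixedAt zero       (fixed false) = true
fixedAt (suc zero) (fixed true)  = true
fixedAt _          _             = false

fixedAt-unique : ∀ k {a a′} → fixedAt k a ≡ true → fixedAt k a′ ≡ true → a ≡ a′
fixedAt-unique zero       {fixed false} {fixed false} _ _ = refl
fixedAt-unique (suc zero) {fixed true}  {fixed true}  _ _ = refl

∑-fixedAt : ∀ b y → ∑[ k < 2 ] (if fixedAt k (fixed b) then y else 0) ≡ y
∑-fixedAt false y = +-identityʳ y
∑-fixedAt true  y = +-identityʳ y

AllFree : ∀ {N} → Vector Coord N → Set
AllFree w = ∀ j → w j ≡ free

Covers : ∀ {N} → Vector Coord N → Vector Coord N → Set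
Covers w w′ = ∀ j → w j ≡ free ⊎ w j ≡ w′ j

covers-removeAt : ∀ {M} {w w′ : Vector Coord (suc M)} e → w e ≡ w′ e →
                  Covers (removeAt w e) (removeAt w′ e) → Covers w w′
covers-removeAt {w = w} {w′} e we≡w′e covers j with j ≟ e
... | yes refl = inj₂ we≡w′e
... | no j≢e   =
  subst (λ i → w i ≡ free ⊎ w i ≡ w′ i) (punchIn-punchOut (j≢e ∘ sym)) (covers (punchOut (j≢e ∘ sym)))

#free+#fixed : ∀ {N} (w : Vector Coord N) → #free w + #fixed w ≡ N
#free+#fixed {N} w = begin
  #free w + #fixed w                   ≡⟨ sym (∑-distrib-+ (χfree ∘ w) (χfixed ∘ w)) ⟩
  ∑[ j < N ] (χfree (w j) + χfixed (w j))  ≡⟨ sum-cong-≗ (one ∘ w) ⟩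
  ∑[ j < N ] 1                         ≡⟨ sum-const N 1 ⟩
  N * 1                                ≡⟨ *-identityʳ N ⟩
  N                                    ∎
  where
  open ≡-Reasoning
  one : ∀ a → χfree a + χfixed a ≡ 1
  one (fixed _) = refl
  one free      = refl

module FaceChains where
  open ChainCounting 2 fixedAt AllFree (λ w → all? (free? ∘ w)) (λ w w′ → ¬ Covers w w′)
    (λ allFree ¬covers _ → ¬covers (inj₁ ∘ allFree))
    (λ e k w∈k w′∈k ¬covers → ¬covers ∘ covers-removeAt e (fixedAt-unique k w∈k w′∈k))
    public

  chainsThrough : ∀ {N} → Vector Coord N → ℕ
  chainsThrough w = 2 ^ #free w * (#free w ! * #fixed w !)

  chainsThrough-allFree : ∀ {N} {w : Vector Coord N} → AllFree w → chainsThrough w ≡ total N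
  chainsThrough-allFree {N} {w} allFree = begin
    2 ^ s * (s ! * r !)   ≡⟨ cong₂ (λ s r → 2 ^ s * (s ! * r !)) s≡N r≡0 ⟩
    2 ^ N * (N ! * 1)     ≡⟨ cong (2 ^ N *_) (*-identityʳ (N !)) ⟩
    2 ^ N * N !           ∎
    where
    open ≡-Reasoning
    s = #free w
    r = #fixed w
    r≡0 : r ≡ 0
    r≡0 = sum-zero (cong χfixed ∘ allFree)
    s≡N : s ≡ N
    s≡N = trans (sym (+-identityʳ s)) (trans (cong (s +_) (sym r≡0)) (#free+#fixed w))

  chainsThrough-removeAt : ∀ {M} (w : Vector Coord (suc M)) e {c} → c ≡ chainsThrough (removeAt w e) →
    ∑[ k < 2 ] (if fixedAt k (w e) then c else 0) * #fixed w ≡ χfixed (w e) * chainsThrough w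
  chainsThrough-removeAt w e {c} c≡ with w e in we
  ... | free    = refl
  ... | fixed b = begin
    ∑[ k < 2 ] (if fixedAt k (fixed b) then c else 0) * r
                                          ≡⟨ cong (_* r) (trans (∑-fixedAt b c) c≡) ⟩
    2 ^ s′ * (s′ ! * r′ !) * r            ≡⟨ cong₂ (λ s″ r″ → 2 ^ s″ * (s″ ! * r′ !) * r″) s′≡s r≡1+r′ ⟩
    2 ^ s * (s ! * r′ !) * suc r′         ≡⟨ regroup (2 ^ s) (s !) (r′ !) r′ ⟩
    1 * (2 ^ s * (s ! * (suc r′ * r′ !))) ≡⟨ cong (λ r″ → 1 * (2 ^ s * (s ! * r″ !))) (sym r≡1+r′) ⟩
    1 * chainsThrough w                   ∎
    where
    open ≡-Reasoning
    s = #free w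
    r = #fixed w
    s′ = #free (removeAt w e)
    r′ = #fixed (removeAt w e)
    s′≡s : s′ ≡ s
    s′≡s = trans (cong (_+ s′) (sym (cong χfree we))) (sym (sum-remove (χfree ∘ w)))
    r≡1+r′ : r ≡ suc r′
    r≡1+r′ = trans (sum-remove (χfixed ∘ w)) (cong (_+ r′) (cong χfixed we))
    regroup : ∀ p a c m → p * (a * c) * suc m ≡ 1 * (p * (a * (suc m * c)))
    regroup = solve-∀

  chains-face : ∀ N (w : Vector Coord N) → chains N w ≡ chainsThrough w
  chains-face N w with all? (free? ∘ w)
  ... | yes allFree = trans (chains-terminal allFree) (sym (chainsThrough-allFree allFree))
  chains-face zero    w | no ¬allFree = ⊥-elim (¬allFree λ ())
  chains-face (suc M) w | no ¬allFree = *-cancelʳ-≡ _ _ r {{>-nonZero r>0}} (begin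
    chains (suc M) w * r                            ≡⟨ cong (_* r) (chains-branching ¬allFree) ⟩
    branching (suc M) w * r                         ≡⟨ *-distribʳ-sum r term ⟩
    ∑[ e < suc M ] (term e * r)
      ≡⟨ sum-cong-≗ (λ e → chainsThrough-removeAt w e (chains-face M (removeAt w e))) ⟩
    ∑[ e < suc M ] (χfixed (w e) * chainsThrough w) ≡⟨ sym (*-distribʳ-sum (chainsThrough w) (χfixed ∘ w)) ⟩
    r * chainsThrough w                             ≡⟨ *-comm r (chainsThrough w) ⟩
    chainsThrough w * r                             ∎)
    where
    open ≡-Reasoning
    r = #fixed w
    term : Fin (suc M) → ℕ
    term e = ∑[ k < 2 ] (if fixedAt k (w e) then chains M (removeAt w e) else 0)
    r>0 : 0 < r
    r>0 with (j , wj≢free) ← ¬∀⟶∃¬ (suc M) _ (free? ∘ w) ¬allFree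
       = ≤-trans (fixed-counts (w j) wj≢free) (≤-sum (χfixed ∘ w) j)
      where
      fixed-counts : ∀ a → ¬ a ≡ free → 0 < χfixed a
      fixed-counts (fixed _) _ = s≤s z≤n
      fixed-counts free a≢free = ⊥-elim (a≢free refl)

  chains-face-*-binom : ∀ N (w : Vector Coord N) →
    chains N w * (binom (#free w) (#fixed w) * 2 ^ #fixed w) ≡ total N
  chains-face-*-binom N w = begin
    chains N w * (binom s r * 2 ^ r)             ≡⟨ cong (_* (binom s r * 2 ^ r)) (chains-face N w) ⟩
    2 ^ s * (s ! * r !) * (binom s r * 2 ^ r)    ≡⟨ regroup (2 ^ s) (2 ^ r) (s ! * r !) (binom s r) ⟩
    2 ^ s * 2 ^ r * (binom s r * (s ! * r !))    ≡⟨ cong₂ _*_ (sym (^-distribˡ-+-* 2 s r)) (binom-*-factorials s r) ⟩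
    2 ^ (s + r) * (s + r) !                      ≡⟨ cong (λ m → 2 ^ m * m !) (#free+#fixed w) ⟩
    2 ^ N * N !                                  ∎
    where
    open ≡-Reasoning
    s = #free w
    r = #fixed w
    regroup : ∀ p p′ f b → p * f * (b * p′) ≡ p * p′ * (b * f)
    regroup = solve-∀

-- Pairs of disjoint sets

data Side : Set where
  inA inB neither : Side

inB? : (a : Side) → Dec (a ≡ inB)
inB? inA     = no λ ()
inB? inB     = yes refl
inB? neither = no λ ()

notInA : Side → Bool
notInA inA = false
notInA _   = true

χA χB χ∅ : Side → ℕ
χA inA = 1
χA _   = 0
χB inB = 1
χB _   = 0
χ∅ neither = 1
χ∅ _       = 0

#A #B #∅ : ∀ {N} → Vector Side N → ℕ
#A v = sum (χA ∘ v)
#B v = sum (χB ∘ v)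
#∅ v = sum (χ∅ ∘ v)

NoB : ∀ {N} → Vector Side N → Set
NoB v = ∀ j → ¬ v j ≡ inB

Meets : ∀ {N} → Vector Side N → Vector Side N → Set
Meets v w = ∃ λ j → v j ≡ inA × w j ≡ inB

notInA⇒≢inA : ∀ {a} → notInA a ≡ true → ¬ a ≡ inA
notInA⇒≢inA {inB}     _ ()
notInA⇒≢inA {neither} _ ()

meets-removeAt : ∀ {M} {v w : Vector Side (suc M)} e → ¬ v e ≡ inA →
                 Meets v w → Meets (removeAt v e) (removeAt w e)
meets-removeAt {v = v} {w} e ve∉A (j , vj≡A , wj≡B) with e Data.Fin.≟ j
... | yes refl = ⊥-elim (ve∉A vj≡A)
... | no e≢j   = punchOut e≢j , subst (λ i → v i ≡ inA × w i ≡ inB) (sym (punchIn-punchOut e≢j)) (vj≡A , wj≡B)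

#A+#B+#∅ : ∀ {N} (v : Vector Side N) → #A v + #B v + #∅ v ≡ N
#A+#B+#∅ {N} v = begin
  #A v + #B v + #∅ v                          ≡⟨ cong (_+ #∅ v) (sym (∑-distrib-+ (χA ∘ v) (χB ∘ v))) ⟩
  ∑[ j < N ] (χA (v j) + χB (v j)) + #∅ v     ≡⟨ sym (∑-distrib-+ (λ j → χA (v j) + χB (v j)) (χ∅ ∘ v)) ⟩
  ∑[ j < N ] (χA (v j) + χB (v j) + χ∅ (v j)) ≡⟨ sum-cong-≗ (one ∘ v) ⟩
  ∑[ j < N ] 1                                ≡⟨ sum-const N 1 ⟩
  N * 1                                       ≡⟨ *-identityʳ N ⟩
  N                                           ∎
  where
  open ≡-Reasoning
  one : ∀ a → χA a + χB a + χ∅ a ≡ 1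
  one inA     = refl
  one inB     = refl
  one neither = refl

module SideChains where
  open ChainCounting 1 (λ _ → notInA) NoB (λ v → all? (λ j → ¬? (inB? (v j)))) Meets
    (λ noB _ (j , _ , vj≡B) → noB j vj≡B)
    (λ e _ ve∉A _ → meets-removeAt e (notInA⇒≢inA ve∉A))
    public

  total≡! : ∀ N → total N ≡ N !
  total≡! N = trans (cong (_* N !) (^-zeroˡ N)) (*-identityˡ (N !))

  chains-side-noB : ∀ {N} {v : Vector Side N} → NoB v → chains N v * binom (#A v) (#B v) ≡ N !
  chains-side-noB {N} {v} noB = begin
    chains N v * binom (#A v) (#B v)   ≡⟨ cong₂ _*_ (trans (chains-terminal noB) (total≡! N)) (cong (binom (#A v)) b≡0) ⟩
    N ! * binom (#A v) 0               ≡⟨ cong (N ! *_) (binom-zeroʳ (#A v)) ⟩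
    N ! * 1                            ≡⟨ *-identityʳ (N !) ⟩
    N !                                ∎
    where
    open ≡-Reasoning
    b≡0 : #B v ≡ 0
    b≡0 = sum-zero λ j → χB≡0 (v j) (noB j)
      where
      χB≡0 : ∀ a → ¬ a ≡ inB → χB a ≡ 0
      χB≡0 inA     _ = refl
      χB≡0 inB     a≢B = ⊥-elim (a≢B refl)
      χB≡0 neither _ = refl

  chains-side-removeAt : ∀ {M} (v : Vector Side (suc M)) e c →
    c * binom (#A (removeAt v e)) (#B (removeAt v e)) ≡ M ! →
    ((if notInA (v e) then c else 0) + 0) * (binom (#A v) (#B v) * #B v) ≡
    χB (v e) * ((#A v + #B v) * M !) + χ∅ (v e) * (#B v * M !)
  chains-side-removeAt {M} v e c c*binom≡M! with v e in ve
  ... | inA     = refl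
  ... | inB     = begin
    (c + 0) * (binom a b * b)            ≡⟨ cong (_* (binom a b * b)) (+-identityʳ c) ⟩
    c * (binom a b * b)                  ≡⟨ cong₂ (λ a″ b″ → c * (binom a″ b″ * b″)) a≡a′ b≡1+b′ ⟩
    c * (binom a′ (suc b′) * suc b′)     ≡⟨ cong (c *_) (binom-sucʳ a′ b′) ⟩
    c * (suc (a′ + b′) * binom a′ b′)    ≡⟨ swap c (suc (a′ + b′)) (binom a′ b′) ⟩
    c * binom a′ b′ * suc (a′ + b′)      ≡⟨ cong (_* suc (a′ + b′)) c*binom≡M! ⟩
    M ! * suc (a′ + b′)                  ≡⟨ expand (M !) a′ b′ ⟩
    1 * ((a′ + suc b′) * M !) + 0 * (suc b′ * M !)
                    ≡⟨ cong₂ (λ a″ b″ → 1 * ((a″ + b″) * M !) + 0 * (b″ * M !)) (sym a≡a′) (sym b≡1+b′) ⟩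
    1 * ((a + b) * M !) + 0 * (b * M !)  ∎
    where
    open ≡-Reasoning
    a = #A v
    b = #B v
    a′ = #A (removeAt v e)
    b′ = #B (removeAt v e)
    a≡a′ : a ≡ a′
    a≡a′ = trans (sum-remove (χA ∘ v)) (cong (λ x → χA x + a′) ve)
    b≡1+b′ : b ≡ suc b′
    b≡1+b′ = trans (sum-remove (χB ∘ v)) (cong (λ x → χB x + b′) ve)
    swap : ∀ x y z → x * (y * z) ≡ x * z * y
    swap = solve-∀
    expand : ∀ m a b → m * suc (a + b) ≡ 1 * ((a + suc b) * m) + 0 * (suc b * m)
    expand = solve-∀
  ... | neither = begin
    (c + 0) * (binom a b * b)            ≡⟨ cong (_* (binom a b * b)) (+-identityʳ c) ⟩
    c * (binom a b * b)                  ≡⟨ sym (*-assoc c (binom a b) b) ⟩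
    c * binom a b * b                    ≡⟨ cong₂ (λ a″ b″ → c * binom a″ b″ * b) a≡a′ b≡b′ ⟩
    c * binom a′ b′ * b                  ≡⟨ cong (_* b) c*binom≡M! ⟩
    M ! * b                              ≡⟨ expand (M !) b (a + b) ⟩
    0 * ((a + b) * M !) + 1 * (b * M !)  ∎
    where
    open ≡-Reasoning
    a = #A v
    b = #B v
    a′ = #A (removeAt v e)
    b′ = #B (removeAt v e)
    a≡a′ : a ≡ a′
    a≡a′ = trans (sum-remove (χA ∘ v)) (cong (λ x → χA x + a′) ve)
    b≡b′ : b ≡ b′
    b≡b′ = trans (sum-remove (χB ∘ v)) (cong (λ x → χB x + b′) ve)
    expand : ∀ m b n → m * b ≡ 0 * n + 1 * (b * m)
    expand = solve-∀

  chains-side : ∀ N (v : Vector Side N) → chains N v * binom (#A v) (#B v) ≡ N !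
  chains-side N v with all? (λ j → ¬? (inB? (v j)))
  ... | yes noB = chains-side-noB noB
  chains-side zero    v | no hasB = ⊥-elim (hasB λ ())
  chains-side (suc M) v | no hasB = *-cancelʳ-≡ _ _ b {{>-nonZero b>0}} (begin
    chains (suc M) v * binom a b * b               ≡⟨ cong (λ c → c * binom a b * b) (chains-branching hasB) ⟩
    branching (suc M) v * binom a b * b            ≡⟨ *-assoc (branching (suc M) v) (binom a b) b ⟩
    branching (suc M) v * (binom a b * b)          ≡⟨ *-distribʳ-sum (binom a b * b) (λ e → ∑[ k < 1 ] term e) ⟩
    ∑[ e < suc M ] ((term e + 0) * (binom a b * b))
      ≡⟨ sum-cong-≗ (λ e → chains-side-removeAt v e (chains M (removeAt v e)) (chains-side M (removeAt v e))) ⟩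
    ∑[ e < suc M ] (χB (v e) * ((a + b) * M !) + χ∅ (v e) * (b * M !))
      ≡⟨ ∑-distrib-+ (λ e → χB (v e) * ((a + b) * M !)) (λ e → χ∅ (v e) * (b * M !)) ⟩
    ∑[ e < suc M ] (χB (v e) * ((a + b) * M !)) + ∑[ e < suc M ] (χ∅ (v e) * (b * M !))
      ≡⟨ sym (cong₂ _+_ (*-distribʳ-sum _ (χB ∘ v)) (*-distribʳ-sum _ (χ∅ ∘ v))) ⟩
    b * ((a + b) * M !) + o * (b * M !)            ≡⟨ collect a b o (M !) ⟩
    (a + b + o) * M ! * b                          ≡⟨ cong (λ m → m * M ! * b) (#A+#B+#∅ v) ⟩
    suc M ! * b                                    ∎)
    where
    open ≡-Reasoning
    a = #A v
    b = #B v
    o = #∅ v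
    term : Fin (suc M) → ℕ
    term e = if notInA (v e) then chains M (removeAt v e) else 0
    collect : ∀ a b o m → b * ((a + b) * m) + o * (b * m) ≡ (a + b + o) * m * b
    collect = solve-∀
    b>0 : 0 < b
    b>0 with (j , vj≡B) ← ¬∀⟶∃¬ (suc M) _ (λ j → ¬? (inB? (v j))) hasB
       = ≤-trans (≤-reflexive (cong χB (sym (decidable-stable (inB? (v j)) vj≡B)))) (≤-sum (χB ∘ v) j)

-- Words of constant weight

splitAt-injective : ∀ m {n} → Injective _≡_ _≡_ (splitAt m {n})
splitAt-injective m {n} {i} {i′} eq =
  trans (sym (join-splitAt m n i)) (trans (cong (join m n) eq) (join-splitAt m n i′))

module _ {A B : Set} {n} {X : Set} {f : A → Vector X n} {g : B → Vector X n} where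

  [,]-injective : Injective _≡_ _≗_ f → Injective _≡_ _≗_ g → (∀ a b → ¬ f a ≗ g b) →
                  Injective _≡_ _≗_ [ f , g ]′
  [,]-injective f-inj g-inj f≢g {inj₁ a} {inj₁ a′} eq = cong inj₁ (f-inj eq)
  [,]-injective f-inj g-inj f≢g {inj₂ b} {inj₂ b′} eq = cong inj₂ (g-inj eq)
  [,]-injective f-inj g-inj f≢g {inj₁ a} {inj₂ b}  eq = ⊥-elim (f≢g a b eq)
  [,]-injective f-inj g-inj f≢g {inj₂ b} {inj₁ a}  eq = ⊥-elim (f≢g a b (sym ∘ eq))

module ConstantWeightWords {X : Set} (weight : X → ℕ) (letters : List X) (distinct : Unique letters) where

  count : ℕ → ℕ → ℕ
  countFrom : List X → ℕ → ℕ → ℕ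
  -- countShifted w n m counts the words of length n and weight m ∸ w when w ≤ m, and is 0 otherwise
  countShifted : ℕ → ℕ → ℕ → ℕ
  count zero    zero    = 1
  count zero    (suc _) = 0
  count (suc n) m       = countFrom letters n m
  countFrom []       n m = 0
  countFrom (a ∷ as) n m = countShifted (weight a) n m + countFrom as n m
  countShifted zero    n m       = count n m
  countShifted (suc w) n zero    = 0
  countShifted (suc w) n (suc m) = countShifted w n m

  word : ∀ n m → Fin (count n m) → Vector X n
  wordFrom : ∀ as n m → Fin (countFrom as n m) → Vector X (suc n)
  wordShifted : ∀ w n m → Fin (countShifted w n m) → Vector X n
  word zero    zero    _ = λ ()
  word (suc n) m       i = wordFrom letters n m i
  wordFrom (a ∷ as) n m i = [ (λ j → a ∷ᵥ wordShifted (weight a) n m j) , wordFrom as n m ]′ (splitAt _ i)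
  wordShifted zero    n m       i = word n m i
  wordShifted (suc w) n (suc m) i = wordShifted w n m i

  Weight : ∀ {n} → Vector X n → ℕ
  Weight {n} v = ∑[ j < n ] weight (v j)

  word-weight : ∀ n m i → Weight (word n m i) ≡ m
  wordFrom-weight : ∀ as n m i → Weight (wordFrom as n m i) ≡ m
  wordShifted-weight : ∀ w n m i → w + Weight (wordShifted w n m i) ≡ m
  word-weight zero    zero    _ = refl
  word-weight (suc n) m       i = wordFrom-weight letters n m i
  wordFrom-weight (a ∷ as) n m i with splitAt (countShifted (weight a) n m) i
  ... | inj₁ j = wordShifted-weight (weight a) n m j
  ... | inj₂ j = wordFrom-weight as n m j
  wordShifted-weight zero    n m       i = word-weight n m i
  wordShifted-weight (suc w) n (suc m) i = cong suc (wordShifted-weight w n m i)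

  wordFrom-head : ∀ as n m i → wordFrom as n m i zero ∈ as
  wordFrom-head (a ∷ as) n m i with splitAt (countShifted (weight a) n m) i
  ... | inj₁ _ = here refl
  ... | inj₂ j = there (wordFrom-head as n m j)

  word-injective : ∀ n m → Injective _≡_ _≗_ (word n m)
  wordFrom-injective : ∀ as → Unique as → ∀ n m → Injective _≡_ _≗_ (wordFrom as n m)
  wordShifted-injective : ∀ w n m → Injective _≡_ _≗_ (wordShifted w n m)
  word-injective zero    zero {zero} {zero} _ = refl
  word-injective (suc n) m = wordFrom-injective letters distinct n m
  wordFrom-injective (a ∷ as) (a∉as ∷ distinct-as) n m =
    splitAt-injective _ ∘ [,]-injective (λ eq → wordShifted-injective (weight a) n m (eq ∘ suc))
                                        (wordFrom-injective as distinct-as n m)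
                                        (λ j j′ eq → All.lookup a∉as (wordFrom-head as n m j′) (eq zero))
  wordShifted-injective zero    n m       = word-injective n m
  wordShifted-injective (suc w) n (suc m) = wordShifted-injective w n m

⋀-true⇒ : ∀ n {g : Fin n → Bool} → ⋀ n g ≡ true → ∀ j → g j ≡ true
⋀-true⇒ (suc n) {g} ⋀≡true zero with g zero
... | true = refl
⋀-true⇒ (suc n) {g} ⋀≡true (suc j) with g zero
... | true = ⋀-true⇒ n ⋀≡true j

⋀-true⇐ : ∀ n {g : Fin n → Bool} → (∀ j → g j ≡ true) → ⋀ n g ≡ true
⋀-true⇐ zero    g≡true = refl
⋀-true⇐ (suc n) g≡true rewrite g≡true zero = ⋀-true⇐ n (g≡true ∘ suc)

⋀-false⇒ : ∀ n {g : Fin n → Bool} → ⋀ n g ≡ false → ∃ λ j → g j ≡ false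
⋀-false⇒ (suc n) {g} ⋀≡false with g zero in g0
... | false = zero , g0
... | true with (j , gj) ← ⋀-false⇒ n ⋀≡false = suc j , gj

module Implementation (α β : Scen) {q n} (I : Implementable α β q n (E q)) where

  u : Fin q → Vector Sym n
  u = proj₁ I

  θ : Fin q → Vector Sym n
  θ t = proj₁ (proj₂ I) (λ x → ⌊ x ≟ t ⌋) (t , λ _ → refl)

  u∈ : ∀ x j → InAlph α (u x j)
  u∈ = proj₁ (proj₂ (proj₂ I))

  private
    implements : ∀ x t → ⌊ x ≟ t ⌋ ≡ ⋀ n (λ j → T (u x j) (θ t j))
    implements x t = proj₂ (proj₂ (proj₂ (proj₂ I))) _ (t , λ _ → refl) x

  T-diagonal : ∀ t j → T (u t j) (θ t j) ≡ true
  T-diagonal t with t ≟ t | implements t t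
  ... | yes _   | 1≡⋀ = ⋀-true⇒ n (sym 1≡⋀)
  ... | no t≢t  | _   = ⊥-elim (t≢t refl)

  T-off-diagonal : ∀ {x t} → ¬ x ≡ t → ∃ λ j → T (u x j) (θ t j) ≡ false
  T-off-diagonal {x} {t} x≢t with x ≟ t | implements x t
  ... | no _    | 0≡⋀ = ⋀-false⇒ n (sym 0≡⋀)
  ... | yes x≡t | _   = ⊥-elim (x≢t x≡t)

≤-by-double-counting : ∀ {q} (g : Fin q → ℕ) K B .{{_ : NonZero K}} →
                       sum g ≤ K → (∀ x → K ≤ g x * B) → q ≤ B
≤-by-double-counting {q} g K B Σg≤K K≤gB = *-cancelʳ-≤ q B K (begin
  q * K              ≡⟨ sym (sum-const q K) ⟩
  ∑[ x < q ] K       ≤⟨ sum-mono-≤ K≤gB ⟩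
  ∑[ x < q ] (g x * B) ≡⟨ sym (*-distribʳ-sum B g) ⟩
  sum g * B          ≤⟨ *-monoˡ-≤ B Σg≤K ⟩
  K * B              ≡⟨ *-comm K B ⟩
  B * K              ∎)
  where open ≤-Reasoning

module _ {X : Set} (α β : Scen) (U Θ : X → Sym) (weight : X → ℕ)
  (U∈ : ∀ a → InAlph α (U a)) (Θ∈ : ∀ a → InAlph β (Θ a))
  (T-diagonal : ∀ a → T (U a) (Θ a) ≡ true)
  (T⇒weight-≤ : ∀ {a b} → T (U a) (Θ b) ≡ true → weight b ≤ weight a)
  (T∧weight-≡⇒≡ : ∀ {a b} → T (U a) (Θ b) ≡ true → weight a ≡ weight b → a ≡ b) where

  implementable-from-words : ∀ {n m K} (word : Fin m → Vector X n) → Injective _≡_ _≗_ word →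
    (∀ i → ∑[ j < n ] weight (word i j) ≡ K) → ∀ q → q ≤ m → Implementable α β q n (E q)
  implementable-from-words {n} word word-injective weight≡K q q≤m =
    (λ x j → U (w x j)) , (λ { _ (t , _) j → Θ (w t j) }) , (λ _ _ → U∈ _) , (λ _ _ _ → Θ∈ _) ,
    λ { f (t , f≡) x → trans (f≡ x) (indicator x t) }
    where
    w : Fin q → Vector X n
    w x = word (inject≤ x q≤m)
    indicator : ∀ x t → ⌊ x ≟ t ⌋ ≡ ⋀ n (λ j → T (U (w x j)) (Θ (w t j)))
    indicator x t with x ≟ t
    ... | yes refl = sym (⋀-true⇐ n (λ j → T-diagonal (w x j)))
    ... | no x≢t with ⋀ n (λ j → T (U (w x j)) (Θ (w t j))) in all-T
    ...   | false = refl
    ...   | true  = ⊥-elim (x≢t (inject≤-injective q≤m q≤m x t (word-injective w≗)))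
      where
      T-at : ∀ j → T (U (w x j)) (Θ (w t j)) ≡ true
      T-at = ⋀-true⇒ n all-T
      weights≡ : ∀ j → weight (w t j) ≡ weight (w x j)
      weights≡ = sum-≤-≡⇒≗ (T⇒weight-≤ ∘ T-at) (trans (weight≡K _) (sym (weight≡K _)))
      w≗ : w x ≗ w t
      w≗ j = T∧weight-≡⇒≡ (T-at j) (sym (weights≡ j))

-- Scenario (*•)

toCoord : Sym → Coord
toCoord s0     = fixed false
toCoord s1     = fixed true
toCoord star   = free
toCoord bullet = free  -- junk: u takes values in 𝔹_* in this scenario

covers⇒T : ∀ {a b} θ → InAlph *ₛ a → InAlph *ₛ b → toCoord a ≡ free ⊎ toCoord a ≡ toCoord b →
           T b θ ≡ true → T a θ ≡ true
covers⇒T {star} θ _ _ _          _   = refl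
covers⇒T {s0} {s0} θ _ _ _       Tbθ = Tbθ
covers⇒T {s1} {s1} θ _ _ _       Tbθ = Tbθ
covers⇒T {s0} {s1}   θ _ _ (inj₂ ()) _
covers⇒T {s0} {star} θ _ _ (inj₂ ()) _
covers⇒T {s1} {s0}   θ _ _ (inj₂ ()) _
covers⇒T {s1} {star} θ _ _ (inj₂ ()) _
covers⇒T {s0} θ _ _ (inj₁ ()) _
covers⇒T {s1} θ _ _ (inj₁ ()) _

boundA-upper : ∀ q n → Implementable *ₛ •ₛ q n (E q) → q ≤ boundA n
boundA-upper q n I = ≤-by-double-counting (chains n ∘ face) (total n) (boundA n) {{total≢0 n}}
  (∑-chains-≤-total n face (λ _ → true) separated) total≤chains*boundA
  where
  open Implementation *ₛ •ₛ I
  open FaceChains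
  face : Fin q → Vector Coord n
  face x = toCoord ∘ u x
  true≢false : ¬ true ≡ false
  true≢false ()
  separated : Separated face (λ _ → true)
  separated x t _ _ x≢t covers with (j , Tx≡false) ← T-off-diagonal x≢t =
    true≢false (trans (sym (covers⇒T (θ t j) (u∈ x j) (u∈ t j) (covers j) (T-diagonal t j))) Tx≡false)
  total≤chains*boundA : ∀ x → total n ≤ chains n (face x) * boundA n
  total≤chains*boundA x = begin
    total n                                   ≡⟨ sym (chains-face-*-binom n (face x)) ⟩
    chains n (face x) * (binom s r * 2 ^ r)
      ≤⟨ *-monoʳ-≤ (chains n (face x)) (binom*2^-≤-boundA n s r (#free+#fixed (face x))) ⟩
    chains n (face x) * boundA n              ∎
    where
    open ≤-Reasoning
    s = #free (face x)
    r = #fixed (face x)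

bitSym : Bool → Sym
bitSym false = s0
bitSym true  = s1

uOf ϑOf : Coord → Sym
uOf (fixed b) = bitSym b
uOf free      = star
ϑOf (fixed b) = bitSym b
ϑOf free      = bullet

module CubeWords where
  open ConstantWeightWords χfree (free ∷ fixed false ∷ fixed true ∷ [])
    (((λ ()) ∷ (λ ()) ∷ []) ∷ ((λ ()) ∷ []) ∷ [] ∷ [])
    public

  count-above : ∀ n m → n < m → count n m ≡ 0
  count-above zero    (suc m) _ = refl
  count-above (suc n) (suc m) (s≤s n<m)
    rewrite count-above n m n<m | count-above n (suc m) (m<n⇒m<1+n n<m) = refl

  count-diagonal : ∀ n → count n n ≡ 1
  count-diagonal zero    = refl
  count-diagonal (suc n) rewrite count-diagonal n | count-above n (suc n) ≤-refl = refl

  count-zero : ∀ n → count n 0 ≡ 2 ^ n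
  count-zero zero    = refl
  count-zero (suc n) rewrite count-zero n = refl

  count-cube : ∀ k l → count (k + l) k ≡ binom k l * 2 ^ l
  count-cube zero    l       = trans (count-zero l) (sym (+-identityʳ (2 ^ l)))
  count-cube (suc k) zero    rewrite +-identityʳ k = count-diagonal (suc k)
  count-cube (suc k) (suc l) = begin
    count (k + suc l) k + (count (k + suc l) (suc k) + (count (k + suc l) (suc k) + 0))
      ≡⟨ cong (λ m → count (k + suc l) k + (count m (suc k) + (count m (suc k) + 0))) (+-suc k l) ⟩
    count (k + suc l) k + (count (suc k + l) (suc k) + (count (suc k + l) (suc k) + 0))
      ≡⟨ cong₂ (λ a b → a + (b + (b + 0))) (count-cube k (suc l)) (count-cube (suc k) l) ⟩
    binom k (suc l) * 2 ^ suc l + (binom (suc k) l * 2 ^ l + (binom (suc k) l * 2 ^ l + 0))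
      ≡⟨ collect (binom k (suc l)) (binom (suc k) l) (2 ^ l) ⟩
    (binom k (suc l) + binom (suc k) l) * 2 ^ suc l
      ∎
    where
    open ≡-Reasoning
    collect : ∀ a b p → a * (2 * p) + (b * p + (b * p + 0)) ≡ (a + b) * (2 * p)
    collect = solve-∀

boundA-lower : ∀ q n → q ≤ boundA n → Implementable *ₛ •ₛ q n (E q)
boundA-lower q n q≤bound =
  implementable-from-words *ₛ •ₛ uOf ϑOf χfree uOf∈ (λ _ → tt) T-diagonal T⇒χfree-≤ T∧χfree-≡⇒≡
    (word n k) (word-injective n k) (word-weight n k) q (subst (q ≤_) (sym count≡boundA) q≤bound)
  where
  open CubeWords
  k = n / 3
  count≡boundA : count n k ≡ boundA n
  count≡boundA = subst (λ m → count m k ≡ (m C k) * 2 ^ ceil2n/3 n) (proj₁ (thirds n))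
    (trans (count-cube k (ceil2n/3 n)) (cong (_* 2 ^ ceil2n/3 n) (binom≡C k (ceil2n/3 n))))
  uOf∈ : ∀ a → InAlph *ₛ (uOf a)
  uOf∈ (fixed false) = tt
  uOf∈ (fixed true)  = tt
  uOf∈ free          = tt
  T-diagonal : ∀ a → T (uOf a) (ϑOf a) ≡ true
  T-diagonal (fixed false) = refl
  T-diagonal (fixed true)  = refl
  T-diagonal free          = refl
  T⇒χfree-≤ : ∀ {a b} → T (uOf a) (ϑOf b) ≡ true → χfree b ≤ χfree a
  T⇒χfree-≤ {free}        {fixed _} _ = z≤n
  T⇒χfree-≤ {free}        {free}    _ = ≤-refl
  T⇒χfree-≤ {fixed _}     {fixed _} _ = z≤n
  T⇒χfree-≤ {fixed false} {free}    ()
  T⇒χfree-≤ {fixed true}  {free}    ()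
  T∧χfree-≡⇒≡ : ∀ {a b} → T (uOf a) (ϑOf b) ≡ true → χfree a ≡ χfree b → a ≡ b
  T∧χfree-≡⇒≡ {free}        {free}        _ _ = refl
  T∧χfree-≡⇒≡ {fixed false} {fixed false} _ _ = refl
  T∧χfree-≡⇒≡ {fixed true}  {fixed true}  _ _ = refl
  T∧χfree-≡⇒≡ {fixed false} {fixed true}  ()
  T∧χfree-≡⇒≡ {fixed true}  {fixed false} ()
  T∧χfree-≡⇒≡ {fixed false} {free}        ()
  T∧χfree-≡⇒≡ {fixed true}  {free}        ()
  T∧χfree-≡⇒≡ {free}        {fixed _}     _ ()

-- Scenario (••)

admits demands : Sym → Bool → Bool
admits s0     σ = not σ
admits s1     σ = σ
admits star   _ = true
admits bullet _ = false
demands s0     σ = not σ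
demands s1     σ = σ
demands star   _ = false
demands bullet _ = true

T-true⇒admits : ∀ u θ σ → T u θ ≡ true → demands θ σ ≡ true → admits u σ ≡ true
T-true⇒admits star θ  σ _ _  = refl
T-true⇒admits s0   s0 σ _ d  = d
T-true⇒admits s1   s1 σ _ d  = d
T-true⇒admits _    star σ _ ()
T-true⇒admits s0   s1     σ ()
T-true⇒admits s0   bullet σ ()
T-true⇒admits s1   s0     σ ()
T-true⇒admits s1   bullet σ ()
T-true⇒admits bullet s0 σ ()
T-true⇒admits bullet s1 σ ()
T-true⇒admits bullet bullet σ ()

T-false⇒ : ∀ u θ → T u θ ≡ false → ∃ λ σ → admits u σ ≡ false × demands θ σ ≡ true
T-false⇒ s0     s1     _ = true  , refl , refl
T-false⇒ s0     bullet _ = true  , refl , refl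
T-false⇒ s1     s0     _ = false , refl , refl
T-false⇒ s1     bullet _ = false , refl , refl
T-false⇒ bullet s0     _ = false , refl , refl
T-false⇒ bullet s1     _ = true  , refl , refl
T-false⇒ bullet bullet _ = false , refl , refl

-- Position (j, σ) lies in A_x when u_x j rejects the bit σ and in B_x when ϑ_x j demands it;
-- T(u, ϑ) = 1 exactly when ϑ demands no bit that u rejects.
side : Sym → Sym → Bool → Side
side u θ σ = if admits u σ then (if demands θ σ then inB else neither) else inA

pairUp : ∀ {A : Set} n → (Bool → Vector A n) → Vector A (n + n)
pairUp n f = [ f true , f false ]′ ∘ splitAt n

slot : ∀ n → Fin n → Bool → Fin (n + n)
slot n j true  = j ↑ˡ n
slot n j false = n ↑ʳ j

pairUp-slot : ∀ {A : Set} n (f : Bool → Vector A n) j σ → pairUp n f (slot n j σ) ≡ f σ j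
pairUp-slot n f j true  = cong [ f true , f false ]′ (splitAt-↑ˡ n j n)
pairUp-slot n f j false = cong [ f true , f false ]′ (splitAt-↑ʳ n n j)

side-inA : ∀ u θ σ → admits u σ ≡ false → side u θ σ ≡ inA
side-inA u θ σ ¬admits rewrite ¬admits = refl

side-inB : ∀ u θ σ → admits u σ ≡ true → demands θ σ ≡ true → side u θ σ ≡ inB
side-inB u θ σ admits demands rewrite admits | demands = refl

boundB-upper : ∀ q n → Implementable •ₛ •ₛ q n (E q) → q ≤ boundB n
boundB-upper q n I = ≤-by-double-counting (chains (n + n) ∘ sides) (total (n + n)) (boundB n) {{total≢0 (n + n)}}
  (∑-chains-≤-total (n + n) sides (λ _ → true) separated) total≤chains*boundB
  where
  open Implementation •ₛ •ₛ I
  open SideChains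
  cellSides : Fin q → Bool → Vector Side n
  cellSides x σ j = side (u x j) (θ x j) σ
  sides : Fin q → Vector Side (n + n)
  sides x = pairUp n (cellSides x)
  separated : Separated sides (λ _ → true)
  separated x t _ _ x≢t
    with (j , Tx≡false) ← T-off-diagonal x≢t
    with (σ , ¬admits , demands) ← T-false⇒ _ _ Tx≡false
    = slot n j σ , x-in-A , t-in-B
    where
    x-in-A : sides x (slot n j σ) ≡ inA
    x-in-A = trans (pairUp-slot n (cellSides x) j σ) (side-inA (u x j) (θ x j) σ ¬admits)
    t-in-B : sides t (slot n j σ) ≡ inB
    t-in-B = trans (pairUp-slot n (cellSides t) j σ)
      (side-inB (u t j) (θ t j) σ (T-true⇒admits (u t j) (θ t j) σ (T-diagonal t j) demands) demands)
  total≤chains*boundB : ∀ x → total (n + n) ≤ chains (n + n) (sides x) * boundB n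
  total≤chains*boundB x = begin
    total (n + n)                            ≡⟨ total≡! (n + n) ⟩
    (n + n) !                                ≡⟨ sym (chains-side (n + n) (sides x)) ⟩
    chains (n + n) (sides x) * binom a b
      ≤⟨ *-monoʳ-≤ (chains (n + n) (sides x)) (binom-≤-boundB n a b a+b≤2n) ⟩
    chains (n + n) (sides x) * boundB n      ∎
    where
    open ≤-Reasoning
    a = #A (sides x)
    b = #B (sides x)
    a+b≤2n : a + b ≤ n + n
    a+b≤2n = ≤-trans (m≤m+n (a + b) (#∅ (sides x))) (≤-reflexive (#A+#B+#∅ (sides x)))

-- T a (dual b) = 1 iff a admits every bit that b admits
dual : Sym → Sym
dual s0     = s0
dual s1     = s1
dual star   = bullet
dual bullet = star

-- the number of bits admitted; words of capacity m correspond to m-subsets of the 2n positions (j, σ)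
capacity : Sym → ℕ
capacity s0     = 1
capacity s1     = 1
capacity star   = 2
capacity bullet = 0

module PairWords where
  open ConstantWeightWords capacity (bullet ∷ s0 ∷ s1 ∷ star ∷ [])
    (((λ ()) ∷ (λ ()) ∷ (λ ()) ∷ []) ∷ ((λ ()) ∷ (λ ()) ∷ []) ∷ ((λ ()) ∷ []) ∷ [] ∷ [])
    public

  count-pairs : ∀ n m → count n m ≡ (n + n) C m
  count-pairs zero    zero          = refl
  count-pairs zero    (suc m)       = refl
  count-pairs (suc n) zero          = trans (+-identityʳ _) (count-pairs n zero)
  count-pairs (suc n) (suc zero)    = begin
    count n 1 + (count n 0 + (count n 0 + 0))
      ≡⟨ cong₂ (λ a b → a + (b + (b + 0))) (count-pairs n 1) (count-pairs n 0) ⟩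
    N C 1 + (1 + (1 + 0))                 ≡⟨ +-comm (N C 1) 2 ⟩
    1 + (N C 0 + N C 1)                   ≡⟨ cong (1 +_) (nCk+nC[k+1]≡[n+1]C[k+1] N 0) ⟩
    suc N C 0 + suc N C 1                 ≡⟨ nCk+nC[k+1]≡[n+1]C[k+1] (suc N) 0 ⟩
    suc (suc N) C 1                       ≡⟨ cong (_C 1) (sym (cong suc (+-suc n n))) ⟩
    (suc n + suc n) C 1                   ∎
    where
    open ≡-Reasoning
    N = n + n
  count-pairs (suc n) (suc (suc m)) = begin
    count n (2 + m) + (count n (1 + m) + (count n (1 + m) + (count n m + 0)))
      ≡⟨ cong₂ (λ a b → a + (b + (b + (count n m + 0)))) (count-pairs n (2 + m)) (count-pairs n (1 + m)) ⟩
    N C (2 + m) + (N C (1 + m) + (N C (1 + m) + (count n m + 0)))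
      ≡⟨ cong (λ c → N C (2 + m) + (N C (1 + m) + (N C (1 + m) + (c + 0)))) (count-pairs n m) ⟩
    N C (2 + m) + (N C (1 + m) + (N C (1 + m) + (N C m + 0)))
      ≡⟨ regroup (N C m) (N C (1 + m)) (N C (2 + m)) ⟩
    (N C m + N C (1 + m)) + (N C (1 + m) + N C (2 + m))
      ≡⟨ cong₂ _+_ (nCk+nC[k+1]≡[n+1]C[k+1] N m) (nCk+nC[k+1]≡[n+1]C[k+1] N (1 + m)) ⟩
    suc N C (1 + m) + suc N C (2 + m)     ≡⟨ nCk+nC[k+1]≡[n+1]C[k+1] (suc N) (1 + m) ⟩
    suc (suc N) C (2 + m)                 ≡⟨ cong (_C (2 + m)) (sym (cong suc (+-suc n n))) ⟩
    (suc n + suc n) C (2 + m)             ∎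
    where
    open ≡-Reasoning
    N = n + n
    regroup : ∀ a b c → c + (b + (b + (a + 0))) ≡ (a + b) + (b + c)
    regroup = solve-∀

boundB-lower : ∀ q n → q ≤ boundB n → Implementable •ₛ •ₛ q n (E q)
boundB-lower q n q≤bound =
  implementable-from-words •ₛ •ₛ (λ a → a) dual capacity (λ _ → tt) (λ _ → tt)
    T-diagonal T⇒capacity-≤ T∧capacity-≡⇒≡
    (word n n) (word-injective n n) (word-weight n n) q (subst (q ≤_) (sym count≡boundB) q≤bound)
  where
  open PairWords
  count≡boundB : count n n ≡ boundB n
  count≡boundB = trans (count-pairs n n) (cong (λ m → (n + m) C n) (sym (+-identityʳ n)))
  T-diagonal : ∀ a → T a (dual a) ≡ true
  T-diagonal s0     = refl
  T-diagonal s1     = refl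
  T-diagonal star   = refl
  T-diagonal bullet = refl
  T⇒capacity-≤ : ∀ {a b} → T a (dual b) ≡ true → capacity b ≤ capacity a
  T⇒capacity-≤ {star}   {s0}     _ = s≤s z≤n
  T⇒capacity-≤ {star}   {s1}     _ = s≤s z≤n
  T⇒capacity-≤ {star}   {star}   _ = ≤-refl
  T⇒capacity-≤ {_}      {bullet} _ = z≤n
  T⇒capacity-≤ {s0}     {s0}     _ = ≤-refl
  T⇒capacity-≤ {s1}     {s1}     _ = ≤-refl
  T⇒capacity-≤ {s0}     {s1}     ()
  T⇒capacity-≤ {s0}     {star}   ()
  T⇒capacity-≤ {s1}     {s0}     ()
  T⇒capacity-≤ {s1}     {star}   ()
  T⇒capacity-≤ {bullet} {s0}     ()
  T⇒capacity-≤ {bullet} {s1}     ()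
  T⇒capacity-≤ {bullet} {star}   ()
  T∧capacity-≡⇒≡ : ∀ {a b} → T a (dual b) ≡ true → capacity a ≡ capacity b → a ≡ b
  T∧capacity-≡⇒≡ {s0}     {s0}     _ _ = refl
  T∧capacity-≡⇒≡ {s1}     {s1}     _ _ = refl
  T∧capacity-≡⇒≡ {star}   {star}   _ _ = refl
  T∧capacity-≡⇒≡ {bullet} {bullet} _ _ = refl
  T∧capacity-≡⇒≡ {star}   {s0}     _ ()
  T∧capacity-≡⇒≡ {star}   {s1}     _ ()
  T∧capacity-≡⇒≡ {star}   {bullet} _ ()
  T∧capacity-≡⇒≡ {s0}     {bullet} _ ()
  T∧capacity-≡⇒≡ {s1}     {bullet} _ ()
  T∧capacity-≡⇒≡ {s0}     {s1}     ()
  T∧capacity-≡⇒≡ {s0}     {star}   ()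
  T∧capacity-≡⇒≡ {s1}     {s0}     ()
  T∧capacity-≡⇒≡ {s1}     {star}   ()
  T∧capacity-≡⇒≡ {bullet} {s0}     ()
  T∧capacity-≡⇒≡ {bullet} {s1}     ()
  T∧capacity-≡⇒≡ {bullet} {star}   ()

proposition5 : (q n : ℕ) → 2 ≤ q → 1 ≤ n →
    (Implementable *ₛ •ₛ q n (E q) ⇔ q ≤ boundA n) ×
    (Implementable •ₛ •ₛ q n (E q) ⇔ q ≤ boundB n)
-- the equivalences hold for all q and n
proposition5 q n _ _ =
  mk⇔ (boundA-upper q n) (boundA-lower q n) ,
  mk⇔ (boundB-upper q n) (boundB-lower q n)
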